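{- Let $X\subset\mathbb{P}^{n+1}$ ($n\ge2$) be a smooth cubic hypersurface over $\mathbb{Q}$ given by $F=0$. Let $B\in X$, $C' \in X_B$ and $D' \in X_{C'}$. Suppose (i) $T_{C'}X \ne T_B X$; (ii) the Hessian $H_F(C')$ has full rank; (iii) $D'$ does not lie on the line $\{(\lambda \nabla F(B) + \mu \nabla F(C'))\cdot H_F(C')^{ -1} : (\lambda:\mu)\in\mathbb{P}^1\}$. Then $C'$ is a smooth point of the variety $Y_{B,D'}\subset\mathbb{P}^{n+1}$.
   Context: $T_PX$ is the hyperplane $\nabla F(P)\cdot x=0$ and $X_P := X\cap T_PX$. $H_F(P) = \left(\frac{\partial^2 F}{\partial x_i\partial x_j}(P)\right)_{i,j=0,\dots,n+1}$; in (iii), row vectors are multiplied by the inverse matrix and viewed as points of $\mathbb{P}^{n+1}$. For points $B,D$ of $X$, $Y_{B,D}$ is defined by $F(x)=0$, $\nabla F(x)\cdot D=0$, $\nabla F(B)\cdot x=0$. -}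

module Defs where

open import Level using (0ℓ)
open import Data.Nat using (ℕ; zero; suc)
open import Data.Fin using (Fin)
import Data.Fin as F
open import Relation.Nullary using (yes; no)
open import Relation.Binary.PropositionalEquality using (_≡_)
open import Data.Product using (Σ; _×_; _,_)
open import Relation.Nullary using (¬_)
open import Algebra.Bundles using (CommutativeRing)
open import Algebra.Morphism.Structures using (IsRingHomomorphism)
import Data.Rational as Q
open import Data.Rational.Properties using (+-*-commutativeRing)

-- Polynomial algebra over an arbitrary commutative ring R.
-- Coordinates of P^{n+1} are indexed by Fin m with m = n + 2.

module Poly (R : CommutativeRing 0ℓ 0ℓ) where
  open CommutativeRing R

  ∑ : (m : ℕ) → (Fin m → Carrier) → Carrier
  ∑ zero    f = 0#
  ∑ (suc m) f = f F.zero + ∑ m (λ i → f (F.suc i))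

  -- a cubic form  F(x) = Σ_{i,j,k} c i j k x_i x_j x_k  is given by its
  -- coefficient array c (every cubic form arises this way)
  Cubic : ℕ → Set
  Cubic m = Fin m → Fin m → Fin m → Carrier

  eval : ∀ {m} → Cubic m → (Fin m → Carrier) → Carrier
  eval {m} c x = ∑ m λ i → ∑ m λ j → ∑ m λ k → c i j k * x i * x j * x k

  grad : ∀ {m} → Cubic m → (Fin m → Carrier) → Fin m → Carrier
  grad {m} c x l = ∑ m λ j → ∑ m λ k →
    (c l j k + c j l k + c j k l) * x j * x k

  hess : ∀ {m} → Cubic m → (Fin m → Carrier) → Fin m → Fin m → Carrier
  hess {m} c x l r = ∑ m λ k →
    (c l r k + c l k r + c r l k + c k l r + c r k l + c k r l) * x k

  _·_ : ∀ {m} → (Fin m → Carrier) → (Fin m → Carrier) → Carrier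
  _·_ {m} u v = ∑ m λ i → u i * v i

  _⊛_ : ∀ {m} → (Fin m → Carrier) → (Fin m → Fin m → Carrier) → Fin m → Carrier
  _⊛_ {m} u M j = ∑ m λ i → u i * M i j

  _⊙_ : ∀ {m} → (Fin m → Fin m → Carrier) → (Fin m → Carrier) → Fin m → Carrier
  _⊙_ {m} M v i = ∑ m λ j → M i j * v j

  _⊗_ : ∀ {m} → (Fin m → Fin m → Carrier) → (Fin m → Fin m → Carrier) → Fin m → Fin m → Carrier
  _⊗_ {m} M N i j = ∑ m λ k → M i k * N k j

  idM : ∀ {m} → Fin m → Fin m → Carrier
  idM i j with i F.≟ j
  ... | yes _ = 1#
  ... | no _  = 0#

  IsZero : ∀ {m} → (Fin m → Carrier) → Set
  IsZero v = ∀ i → v i ≈ 0#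

  IsInverse : ∀ {m} → (Fin m → Fin m → Carrier) → (Fin m → Fin m → Carrier) → Set
  IsInverse M N = (∀ i j → (M ⊗ N) i j ≈ idM i j) × (∀ i j → (N ⊗ M) i j ≈ idM i j)

  LinIndep3 : ∀ {m} → (Fin m → Carrier) → (Fin m → Carrier) → (Fin m → Carrier) → Set
  LinIndep3 u v w = ∀ a b d → IsZero (λ i → a * u i + b * v i + d * w i) →
    (a ≈ 0#) × (b ≈ 0#) × (d ≈ 0#)

-- Fields extending ℚ (used to express geometric smoothness, i.e. over ℚ̄;
-- a projective hypersurface is smooth iff its partials have no common
-- nontrivial zero over any field extension of ℚ).

record FieldOverℚ : Set₁ where
  field
    K      : CommutativeRing 0ℓ 0ℓ
  open CommutativeRing K
  field
    ι      : Q.ℚ → Carrier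
    ι-hom  : IsRingHomomorphism (CommutativeRing.rawRing +-*-commutativeRing) rawRing ι
    0≉1    : ¬ (0# ≈ 1#)
    inv    : ∀ x → ¬ (x ≈ 0#) → Σ Carrier λ y → x * y ≈ 1#

module QP = Poly +-*-commutativeRing

CubicQ : ℕ → Set
CubicQ = QP.Cubic

VecQ : ℕ → Set
VecQ m = Fin m → Q.ℚ

SmoothCubic : ∀ {m} → CubicQ m → Set₁
SmoothCubic {m} c = (L : FieldOverℚ) →
  let open FieldOverℚ L
      open Poly K
  in (x : Fin m → CommutativeRing.Carrier K) →
     IsZero (grad (λ i j k → ι (c i j k)) x) → IsZero x

OnX : ∀ {m} → CubicQ m → VecQ m → Set
OnX c P = ¬ QP.IsZero P × QP.eval c P ≡ Q.0ℚ

InTangent : ∀ {m} → CubicQ m → (Q P : VecQ m) → Set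
InTangent c Q P = QP._·_ (QP.grad c Q) P ≡ Q.0ℚ

-- T_P X ≠ T_Q X as hyperplanes {∇F(P)·x = 0}, {∇F(Q)·x = 0}:
-- the defining linear forms are not nonzero multiples of each other.
TangentsDiffer : ∀ {m} → CubicQ m → (P Q : VecQ m) → Set
TangentsDiffer c P Q = ¬ (Σ Q.ℚ λ t → ¬ (t ≡ Q.0ℚ) ×
  (∀ i → QP.grad c P i ≡ t Q.* QP.grad c Q i))

-- D lies on the line {(λ ∇F(B) + μ ∇F(C)) · Hinv : (λ:μ) ∈ P¹}
-- (D is a nonzero vector, so projective equality is absorbed into λ, μ)
OnLine : ∀ {m} → CubicQ m → (B C D : VecQ m) → (Hinv : Fin m → Fin m → Q.ℚ) → Set
OnLine {m} c B C D Hinv = Σ Q.ℚ λ lam → Σ Q.ℚ λ mu →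
  Σ Q.ℚ λ t → ¬ (t ≡ Q.0ℚ) ×
  (∀ i → D i ≡
     t Q.* QP._⊛_ (λ j → lam Q.* QP.grad c B j Q.+ mu Q.* QP.grad c C j) Hinv i)

-- A point P of Y is a smooth
-- point of Y (Jacobian criterion for the codimension-3 variety Y): the
-- gradients of the three defining equations at P, namely ∇F(P), H_F(P)·D
-- and ∇F(B), are linearly independent.
OnY : ∀ {m} → CubicQ m → (B D P : VecQ m) → Set
OnY c B D P = OnX c P ×
  (QP._·_ (QP.grad c P) D ≡ Q.0ℚ) ×
  (QP._·_ (QP.grad c B) P ≡ Q.0ℚ)

SmoothPointOfY : ∀ {m} → CubicQ m → (B D P : VecQ m) → Set
SmoothPointOfY c B D P = OnY c B D P ×
  QP.LinIndep3 (QP.grad c P) (QP._⊙_ (QP.hess c P) D) (QP.grad c B)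

-- A relation
-- a ∇F(C') + b H_F(C')·D' + d ∇F(B) = 0 with b ≠ 0 expresses H_F(C')·D' in the
-- span of ∇F(B), ∇F(C'); multiplying by H_F(C')⁻¹ (the Hessian is symmetric)
-- puts D' on the excluded line.  With b = 0 it is a relation between ∇F(C')
-- and ∇F(B), which are nonzero since X is smooth and not proportional since
-- T_{C'}X ≠ T_B X, so a = d = 0.
module Submission where

open import Defs
open import Data.Nat using (ℕ; suc; _≤_)
open import Data.Fin using (Fin)
open import Relation.Nullary using (¬_)
import Data.Rational as Q

open import Level using (0ℓ)
open import Data.Nat using (zero)
import Data.Fin as F
open import Data.Product using (Σ; _×_; _,_)
open import Data.Empty using (⊥; ⊥-elim)
open import Relation.Nullary using (Dec; yes; no)
open import Relation.Binary.PropositionalEquality as ≡ using (_≡_; module ≡-Reasoning)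
open import Algebra.Bundles using (CommutativeRing)
import Algebra.Properties.Semiring.Sum as SemiringSum
import Algebra.Solver.CommutativeMonoid as CommutativeMonoidSolver
import Relation.Binary.Reasoning.Setoid as SetoidReasoning

module Matrices (R : CommutativeRing 0ℓ 0ℓ) where
  open CommutativeRing R
  open Poly R
  open SemiringSum semiring
    using (sum; *-distribˡ-sum; *-distribʳ-sum; ∑-comm; sum-cong-≋; sum-cong-≗; sum-replicate-zero)
  open SetoidReasoning setoid

  -- Poly's ∑ is the library's sum only up to propositional equality, so the
  -- library's summation lemmas are transported along ∑≡sum.
  ∑≡sum : ∀ m (f : Fin m → Carrier) → ∑ m f ≡ sum f
  ∑≡sum zero    f = ≡.refl
  ∑≡sum (suc m) f = ≡.cong (f F.zero +_) (∑≡sum m (λ i → f (F.suc i)))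

  ∑-cong : ∀ m {f g : Fin m → Carrier} → (∀ i → f i ≈ g i) → ∑ m f ≈ ∑ m g
  ∑-cong m {f} {g} f≈g = begin
    ∑ m f ≡⟨ ∑≡sum m f ⟩
    sum f ≈⟨ sum-cong-≋ f≈g ⟩
    sum g ≡⟨ ∑≡sum m g ⟨
    ∑ m g ∎

  ∑-zero : ∀ m → ∑ m (λ _ → 0#) ≈ 0#
  ∑-zero m = trans (reflexive (∑≡sum m _)) (sum-replicate-zero m)

  *-distribˡ-∑ : ∀ m x (f : Fin m → Carrier) → x * ∑ m f ≈ ∑ m (λ i → x * f i)
  *-distribˡ-∑ m x f = begin
    x * ∑ m f               ≡⟨ ≡.cong (x *_) (∑≡sum m f) ⟩
    x * sum f               ≈⟨ *-distribˡ-sum x f ⟩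
    sum (λ i → x * f i)     ≡⟨ ∑≡sum m _ ⟨
    ∑ m (λ i → x * f i)     ∎

  *-distribʳ-∑ : ∀ m x (f : Fin m → Carrier) → ∑ m f * x ≈ ∑ m (λ i → f i * x)
  *-distribʳ-∑ m x f = begin
    ∑ m f * x               ≡⟨ ≡.cong (_* x) (∑≡sum m f) ⟩
    sum f * x               ≈⟨ *-distribʳ-sum x f ⟩
    sum (λ i → f i * x)     ≡⟨ ∑≡sum m _ ⟨
    ∑ m (λ i → f i * x)     ∎

  ∑-swap : ∀ m n (f : Fin m → Fin n → Carrier) →
           ∑ m (λ i → ∑ n (f i)) ≈ ∑ n (λ j → ∑ m (λ i → f i j))
  ∑-swap m n f = begin
    ∑ m (λ i → ∑ n (f i))               ≡⟨ nested m n f ⟩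
    sum (λ i → sum (f i))               ≈⟨ ∑-comm f ⟩
    sum (λ j → sum (λ i → f i j))       ≡⟨ nested n m (λ j i → f i j) ⟨
    ∑ n (λ j → ∑ m (λ i → f i j))       ∎
    where
    nested : ∀ m n (g : Fin m → Fin n → Carrier) → ∑ m (λ i → ∑ n (g i)) ≡ sum (λ i → sum (g i))
    nested m n g = ≡.trans (∑≡sum m _) (sum-cong-≗ (λ i → ∑≡sum n (g i)))

  Symmetric : ∀ {m} → (Fin m → Fin m → Carrier) → Set
  Symmetric M = ∀ i j → M i j ≈ M j i

  idM-diag : ∀ {m} (i : Fin m) → idM i i ≈ 1#
  idM-diag i with i F.≟ i
  ... | yes _ = refl
  ... | no i≢i = ⊥-elim (i≢i ≡.refl)

  idM-suc : ∀ {m} (i j : Fin m) → idM (F.suc i) (F.suc j) ≈ idM i j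
  idM-suc i j with i F.≟ j
  ... | yes _ = refl
  ... | no _  = refl

  ⊛-identityʳ : ∀ {m} (v : Fin m → Carrier) i → (v ⊛ idM) i ≈ v i
  ⊛-identityʳ {suc m} v F.zero = begin
    v F.zero * idM (F.zero {m}) F.zero + ∑ m (λ k → v (F.suc k) * 0#)
      ≈⟨ +-cong (*-congˡ (idM-diag (F.zero {suc m}))) (∑-cong m (λ k → zeroʳ (v (F.suc k)))) ⟩
    v F.zero * 1# + ∑ m (λ _ → 0#)
      ≈⟨ +-cong (*-identityʳ (v F.zero)) (∑-zero m) ⟩
    v F.zero + 0#
      ≈⟨ +-identityʳ (v F.zero) ⟩
    v F.zero ∎
  ⊛-identityʳ {suc m} v (F.suc i) = begin
    v F.zero * 0# + ∑ m (λ k → v (F.suc k) * idM (F.suc k) (F.suc i))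
      ≈⟨ +-cong (zeroʳ (v F.zero)) (∑-cong m (λ k → *-congˡ (idM-suc k i))) ⟩
    0# + ((λ k → v (F.suc k)) ⊛ idM) i
      ≈⟨ +-identityˡ _ ⟩
    ((λ k → v (F.suc k)) ⊛ idM) i
      ≈⟨ ⊛-identityʳ (λ k → v (F.suc k)) i ⟩
    v (F.suc i) ∎

  ⊛-congʳ : ∀ {m} {u v : Fin m → Carrier} (M : Fin m → Fin m → Carrier) →
            (∀ i → u i ≈ v i) → ∀ j → (u ⊛ M) j ≈ (v ⊛ M) j
  ⊛-congʳ {m} M u≈v j = ∑-cong m (λ i → *-congʳ (u≈v i))

  ⊛-congˡ : ∀ {m} (v : Fin m → Carrier) {M N : Fin m → Fin m → Carrier} →
            (∀ i j → M i j ≈ N i j) → ∀ j → (v ⊛ M) j ≈ (v ⊛ N) j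
  ⊛-congˡ {m} v M≈N j = ∑-cong m (λ i → *-congˡ (M≈N i j))

  ⊛-⊗-assoc : ∀ {m} (v : Fin m → Carrier) (M N : Fin m → Fin m → Carrier) →
              ∀ i → ((v ⊛ M) ⊛ N) i ≈ (v ⊛ (M ⊗ N)) i
  ⊛-⊗-assoc {m} v M N i = begin
    ∑ m (λ j → ∑ m (λ k → v k * M k j) * N j i)    ≈⟨ ∑-cong m (λ j → *-distribʳ-∑ m (N j i) _) ⟩
    ∑ m (λ j → ∑ m (λ k → v k * M k j * N j i))    ≈⟨ ∑-swap m m _ ⟩
    ∑ m (λ k → ∑ m (λ j → v k * M k j * N j i))    ≈⟨ ∑-cong m (λ k → ∑-cong m (λ j → *-assoc (v k) _ _)) ⟩
    ∑ m (λ k → ∑ m (λ j → v k * (M k j * N j i)))  ≈⟨ ∑-cong m (λ k → *-distribˡ-∑ m (v k) _) ⟨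
    ∑ m (λ k → v k * (M ⊗ N) k i)                  ∎

  ⊙≈⊛ : ∀ {m} {M : Fin m → Fin m → Carrier} → Symmetric M →
        ∀ (v : Fin m → Carrier) j → (M ⊙ v) j ≈ (v ⊛ M) j
  ⊙≈⊛ {m} M-sym v j = ∑-cong m (λ k → trans (*-comm _ (v k)) (*-congˡ (M-sym j k)))

  ⊙-⊛-rightInverse : ∀ {m} {M N : Fin m → Fin m → Carrier} → Symmetric M →
                     (∀ i j → (M ⊗ N) i j ≈ idM i j) →
                     ∀ (v : Fin m → Carrier) i → ((M ⊙ v) ⊛ N) i ≈ v i
  ⊙-⊛-rightInverse {M = M} {N} M-sym MN≈1 v i = begin
    ((M ⊙ v) ⊛ N) i    ≈⟨ ⊛-congʳ N (⊙≈⊛ M-sym v) i ⟩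
    ((v ⊛ M) ⊛ N) i    ≈⟨ ⊛-⊗-assoc v M N i ⟩
    (v ⊛ (M ⊗ N)) i    ≈⟨ ⊛-congˡ v MN≈1 i ⟩
    (v ⊛ idM) i        ≈⟨ ⊛-identityʳ v i ⟩
    v i                ∎

  hess-symmetric : ∀ {m} (c : Cubic m) x → Symmetric (hess c x)
  hess-symmetric {m} c x l r = ∑-cong m (λ k →
    *-congʳ (permute (c l r k) (c l k r) (c r l k) (c k l r) (c r k l) (c k r l)))
    where
    open CommutativeMonoidSolver +-commutativeMonoid using (solve; _⊕_; _⊜_)
    permute : ∀ a b c d e f → a + b + c + d + e + f ≈ c + e + a + f + b + d
    permute = solve 6 (λ a b c d e f → ((((a ⊕ b) ⊕ c) ⊕ d) ⊕ e) ⊕ f ⊜ ((((c ⊕ e) ⊕ a) ⊕ f) ⊕ b) ⊕ d) refl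

open import Data.Rational using (ℚ; NonZero; _+_; _*_; -_; 0ℚ; 1ℚ; 1/_; ≢-nonZero)
open import Data.Rational.Properties
  using (_≟_; +-*-commutativeRing; *-inverseˡ; *-inverseʳ; *-identityˡ; *-zeroˡ; *-zeroʳ; +-identityˡ; +-identityʳ; *-assoc)
open import Data.Rational.Solver using (module +-*-Solver)
import Algebra.Morphism.Construct.Identity as Identity
open Matrices +-*-commutativeRing using (hess-symmetric; ⊛-congʳ; ⊙-⊛-rightInverse)
open QP using (grad; hess; _⊙_; _⊛_; _⊗_; idM; IsZero; LinIndep3)
open ≡-Reasoning

ℚ-overℚ : FieldOverℚ
ℚ-overℚ = record
  { K     = +-*-commutativeRing
  ; ι     = λ q → q
  ; ι-hom = Identity.isRingHomomorphism (CommutativeRing.rawRing +-*-commutativeRing) ≡.refl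
  ; 0≉1   = λ ()
  ; inv   = λ x x≢0 → let instance _ = ≢-nonZero x≢0 in 1/ x , *-inverseʳ x
  }

grad-nonzero : ∀ {m} (c : CubicQ m) {P : VecQ m} → SmoothCubic c → OnX c P → ¬ IsZero (grad c P)
grad-nonzero c smooth (P≢0 , _) ∇F[P]≡0 = P≢0 (smooth ℚ-overℚ _ ∇F[P]≡0)

solve-linear : ∀ a .{{_ : NonZero a}} x y → a * x + y ≡ 0ℚ → x ≡ - (1/ a) * y
solve-linear a x y ax+y≡0 = begin
  x                                   ≡⟨ *-identityˡ x ⟨
  1ℚ * x                              ≡⟨ ≡.cong (_* x) (*-inverseˡ a) ⟨
  1/ a * a * x                        ≡⟨ rearrange (1/ a) a x y ⟩
  1/ a * (a * x + y) + - (1/ a) * y   ≡⟨ ≡.cong (λ s → 1/ a * s + - (1/ a) * y) ax+y≡0 ⟩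
  1/ a * 0ℚ + - (1/ a) * y            ≡⟨ ≡.cong (_+ - (1/ a) * y) (*-zeroʳ (1/ a)) ⟩
  0ℚ + - (1/ a) * y                   ≡⟨ +-identityˡ _ ⟩
  - (1/ a) * y                        ∎
  where
  open +-*-Solver
  rearrange : ∀ a⁻¹ a x y → a⁻¹ * a * x ≡ a⁻¹ * (a * x + y) + - a⁻¹ * y
  rearrange = solve 4 (λ a⁻¹ a x y → a⁻¹ :* a :* x := a⁻¹ :* (a :* x :+ y) :+ :- a⁻¹ :* y) ≡.refl

isolate-middle : ∀ a b .{{_ : NonZero b}} d u h w → a * u + b * h + d * w ≡ 0ℚ →
                 h ≡ (- (1/ b) * d) * w + (- (1/ b) * a) * u
isolate-middle a b d u h w rel = begin
  h                                          ≡⟨ solve-linear b h (a * u + d * w) (≡.trans (reorder a b d u h w) rel) ⟩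
  - (1/ b) * (a * u + d * w)                 ≡⟨ distribute (1/ b) a d u w ⟩
  (- (1/ b) * d) * w + (- (1/ b) * a) * u    ∎
  where
  open +-*-Solver
  reorder : ∀ a b d u h w → b * h + (a * u + d * w) ≡ a * u + b * h + d * w
  reorder = solve 6 (λ a b d u h w → b :* h :+ (a :* u :+ d :* w) := a :* u :+ b :* h :+ d :* w) ≡.refl
  distribute : ∀ b⁻¹ a d u w → - b⁻¹ * (a * u + d * w) ≡ (- b⁻¹ * d) * w + (- b⁻¹ * a) * u
  distribute = solve 5 (λ b⁻¹ a d u w → :- b⁻¹ :* (a :* u :+ d :* w) := (:- b⁻¹ :* d) :* w :+ (:- b⁻¹ :* a) :* u) ≡.refl

Proportional : ∀ {m} → VecQ m → VecQ m → Set
Proportional u v = Σ ℚ λ t → ¬ t ≡ 0ℚ × (∀ i → u i ≡ t * v i)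

LinIndep2 : ∀ {m} → VecQ m → VecQ m → Set
LinIndep2 u v = ∀ a d → IsZero (λ i → a * u i + d * v i) → a ≡ 0ℚ × d ≡ 0ℚ

nonproportional⇒linIndep2 : ∀ {m} (u v : VecQ m) → ¬ IsZero u → ¬ IsZero v →
                            ¬ Proportional u v → LinIndep2 u v
nonproportional⇒linIndep2 u v u≢0 v≢0 nonproportional a d rel
  with a ≟ 0ℚ | d ≟ 0ℚ
... | yes a≡0 | yes d≡0 = a≡0 , d≡0
... | yes ≡.refl | no d≢0 = ⊥-elim (v≢0 v≡0)
  where
  instance _ = ≢-nonZero d≢0
  v≡0 : IsZero v
  v≡0 i = begin
    v i              ≡⟨ solve-linear d (v i) 0ℚ dv+0≡0 ⟩
    - (1/ d) * 0ℚ    ≡⟨ *-zeroʳ (- (1/ d)) ⟩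
    0ℚ               ∎
    where
    dv+0≡0 : d * v i + 0ℚ ≡ 0ℚ
    dv+0≡0 = begin
      d * v i + 0ℚ           ≡⟨ +-identityʳ _ ⟩
      d * v i                ≡⟨ +-identityˡ _ ⟨
      0ℚ + d * v i           ≡⟨ ≡.cong (_+ d * v i) (*-zeroˡ (u i)) ⟨
      0ℚ * u i + d * v i     ≡⟨ rel i ⟩
      0ℚ                     ∎
... | no a≢0 | _ = ⊥-elim (refute (- (1/ a) * d ≟ 0ℚ))
  where
  instance _ = ≢-nonZero a≢0
  u≡t*v : ∀ i → u i ≡ (- (1/ a) * d) * v i
  u≡t*v i = ≡.trans (solve-linear a (u i) (d * v i) (rel i)) (≡.sym (*-assoc (- (1/ a)) d (v i)))
  refute : Dec (- (1/ a) * d ≡ 0ℚ) → ⊥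
  refute (yes t≡0) = u≢0 λ i → begin
    u i                      ≡⟨ u≡t*v i ⟩
    (- (1/ a) * d) * v i     ≡⟨ ≡.cong (_* v i) t≡0 ⟩
    0ℚ * v i                 ≡⟨ *-zeroˡ (v i) ⟩
    0ℚ                       ∎
  refute (no t≢0) = nonproportional (_ , t≢0 , u≡t*v)

linIndep3-intro : ∀ {m} (u v w : VecQ m) → LinIndep2 u w →
  (∀ a b d → ¬ b ≡ 0ℚ → IsZero (λ i → a * u i + b * v i + d * w i) → ⊥) →
  LinIndep3 u v w
linIndep3-intro u v w u,w-independent no-relation-with-v a b d rel with b ≟ 0ℚ
... | no b≢0  = ⊥-elim (no-relation-with-v a b d b≢0 rel)
... | yes b≡0 =
  let a≡0 , d≡0 = u,w-independent a d (λ i → drop-middle (a * u i) (v i) (d * w i) (rel i))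
  in a≡0 , b≡0 , d≡0
  where
  drop-middle : ∀ x y z → x + b * y + z ≡ 0ℚ → x + z ≡ 0ℚ
  drop-middle x y z x+by+z≡0 = begin
    x + z              ≡⟨ ≡.cong (_+ z) (+-identityʳ x) ⟨
    x + 0ℚ + z         ≡⟨ ≡.cong (λ t → x + t + z) (*-zeroˡ y) ⟨
    x + 0ℚ * y + z     ≡⟨ ≡.cong (λ t → x + t * y + z) b≡0 ⟨
    x + b * y + z      ≡⟨ x+by+z≡0 ⟩
    0ℚ                 ∎

relation⇒onLine : ∀ {m} (c : CubicQ m) (B C D : VecQ m) (Hinv : Fin m → Fin m → ℚ) →
  (∀ i j → (hess c C ⊗ Hinv) i j ≡ idM i j) →
  ∀ a b d → ¬ b ≡ 0ℚ →
  (∀ i → a * grad c C i + b * (hess c C ⊙ D) i + d * grad c B i ≡ 0ℚ) →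
  OnLine c B C D Hinv
relation⇒onLine c B C D Hinv H⊗Hinv≡1 a b d b≢0 rel = λ′ , μ′ , 1ℚ , (λ ()) , D≡
  where
  instance _ = ≢-nonZero b≢0
  λ′ = - (1/ b) * d
  μ′ = - (1/ b) * a
  ℓ : VecQ _
  ℓ j = λ′ * grad c B j + μ′ * grad c C j
  D≡ : ∀ i → D i ≡ 1ℚ * (ℓ ⊛ Hinv) i
  D≡ i = begin
    D i                          ≡⟨ ⊙-⊛-rightInverse (hess-symmetric c C) H⊗Hinv≡1 D i ⟨
    ((hess c C ⊙ D) ⊛ Hinv) i    ≡⟨ ⊛-congʳ Hinv (λ j → isolate-middle a b d _ _ _ (rel j)) i ⟩
    (ℓ ⊛ Hinv) i                 ≡⟨ *-identityˡ _ ⟨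
    1ℚ * (ℓ ⊛ Hinv) i            ∎

lemma6p1 : (n : ℕ) → 2 ≤ n →
    (c : CubicQ (suc (suc n))) → SmoothCubic c →
    (B C' D' : VecQ (suc (suc n))) →
    OnX c B →
    OnX c C' → InTangent c B C' →
    OnX c D' → InTangent c C' D' →
    TangentsDiffer c C' B →
    (Hinv : Fin (suc (suc n)) → Fin (suc (suc n)) → Q.ℚ) →
    QP.IsInverse (QP.hess c C') Hinv →
    ¬ OnLine c B C' D' Hinv →
    SmoothPointOfY c B D' C'
lemma6p1 _ _ c smooth B C' D' B∈X C'∈X C'∈T_BX _ D'∈T_C'X tangents-differ Hinv (H⊗Hinv≡1 , _) D'∉line =
  (C'∈X , D'∈T_C'X , C'∈T_BX) ,
  linIndep3-intro (grad c C') (hess c C' ⊙ D') (grad c B)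
    (nonproportional⇒linIndep2 (grad c C') (grad c B)
      (grad-nonzero c smooth C'∈X) (grad-nonzero c smooth B∈X) tangents-differ)
    (λ a b d b≢0 rel → D'∉line (relation⇒onLine c B C' D' Hinv H⊗Hinv≡1 a b d b≢0 rel))
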